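{- Let $G$ be a finite simple graph containing no induced chordless cycle on 4 vertices and in which $|F_e|\le 3$ for every edge $e$. Let $u,v,w$ be an induced path on 3 vertices in $G$, and define $A,B,C,D$, $B_i$, $E_i$ and $j$ as in the context. If $j\ge 2$ (possibly $j=\infty$), then the subgraph of $G$ induced by $\bigcup_{2\le i\le j} B_i$ is a disjoint union of at most $|E_1|$ paths.
   Context: For an edge $e$ of $G$, $F_e$ is the set of all edges $e'$ of $G$ such that $V(e)\cup V(e')$ induces a path on 3 vertices in $G$. Let $u,v,w$ be an induced path on 3 vertices ($uv,vw\in E(G)$, $uw\notin E(G)$) and $A=\{u,v,w\}$. Let $B$ be the set of vertices not in $A$ having exactly one or two neighbors in $A$; $C$ the set of vertices having three neighbors in $A$; $D$ the set of vertices not in $A\cup B\cup C$ having at least one neighbor in $C$. For $i\ge 1$, $B_i$ is the set of vertices $x\notin A\cup B\cup C\cup D$ whose minimum distance in $G$ to a vertex of $B$ is exactly $i$; also $B_0=B$. For $i\ge 0$, $E_i$ is the set of edges with one endpoint in $B_i$ and the other in $B_{i+1}$. $j$ is the minimum index $i\ge 0$ such that some edge $e\in E_i$ has $|F_e|\ge 3$; if no such index exists, $j=\infty$. -}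

module Defs where

open import Data.Nat using (ℕ; zero; suc; _+_; _≤_; _<_)
open import Data.Fin using (Fin; toℕ)
open import Data.Bool using (Bool; true; false; T)
open import Data.List using (List; []; _∷_; length; concat)
open import Data.List.Relation.Unary.All using (All)
open import Data.List.Relation.Unary.Unique.Propositional using (Unique)
open import Data.List.Membership.Propositional using (_∈_)
open import Data.Product using (Σ; ∃; _×_; _,_)
open import Data.Sum using (_⊎_)
open import Data.Empty using (⊥)
open import Data.Unit using (⊤)
open import Relation.Nullary using (¬_)
open import Relation.Binary.PropositionalEquality using (_≡_; _≢_)
open import Function.Bundles using (_⇔_)

record Graph (n : ℕ) : Set where
  field
    adj     : Fin n → Fin n → Bool
    adj-sym : ∀ x y → adj x y ≡ adj y x
    adj-irr : ∀ x → adj x x ≡ false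

open Graph public

module _ {n : ℕ} (G : Graph n) where

  Adj : Fin n → Fin n → Set
  Adj x y = T (adj G x y)

  -- an edge {a,b} is represented canonically by the ordered pair (a , b), a < b
  IsEdge : Fin n × Fin n → Set
  IsEdge (a , b) = (toℕ a < toℕ b) × Adj a b

  VV : Fin n × Fin n → Fin n × Fin n → Fin n → Set
  VV (a , b) (c , d) t = t ≡ a ⊎ t ≡ b ⊎ t ≡ c ⊎ t ≡ d

  InducesP3 : (Fin n → Set) → Set
  InducesP3 S = Σ (Fin n) λ x → Σ (Fin n) λ y → Σ (Fin n) λ z →
    x ≢ y × y ≢ z × x ≢ z ×
    (∀ t → S t ⇔ (t ≡ x ⊎ t ≡ y ⊎ t ≡ z)) ×
    Adj x y × Adj y z × ¬ Adj x z

  InF : Fin n × Fin n → Fin n × Fin n → Set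
  InF e e' = IsEdge e' × InducesP3 (VV e e')

  C4Free : Set
  C4Free = ∀ a b c d →
    a ≢ b → a ≢ c → a ≢ d → b ≢ c → b ≢ d → c ≢ d →
    Adj a b → Adj b c → Adj c d → Adj d a →
    ¬ (¬ Adj a c × ¬ Adj b d)

  data Walk : ℕ → Fin n → Fin n → Set where
    nil  : ∀ {x} → Walk zero x x
    cons : ∀ {k x y z} → Adj x y → Walk k y z → Walk (suc k) x z

AtLeast : {X : Set} → ℕ → (X → Set) → Set
AtLeast {X} k P = Σ (List X) λ xs → length xs ≡ k × Unique xs × All P xs

AtMost : {X : Set} → ℕ → (X → Set) → Set
AtMost k P = ¬ AtLeast (suc k) P

data ℕ∞ : Set where
  fin : ℕ → ℕ∞
  ∞   : ℕ∞

_≤∞_ : ℕ → ℕ∞ → Set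
i ≤∞ fin k = i ≤ k
i ≤∞ ∞     = ⊤

module Layers {n : ℕ} (G : Graph n) (u v w : Fin n) where

  b2n : Bool → ℕ
  b2n true  = 1
  b2n false = 0

  nA : Fin n → ℕ
  nA x = b2n (adj G x u) + b2n (adj G x v) + b2n (adj G x w)

  InA : Fin n → Set
  InA x = x ≡ u ⊎ x ≡ v ⊎ x ≡ w

  InB : Fin n → Set
  InB x = ¬ InA x × (nA x ≡ 1 ⊎ nA x ≡ 2)

  InC : Fin n → Set
  InC x = nA x ≡ 3

  InD : Fin n → Set
  InD x = ¬ InA x × ¬ InB x × ¬ InC x × Σ (Fin n) λ c → InC c × Adj G x c

  DistB : Fin n → ℕ → Set
  DistB x i = (Σ (Fin n) λ b → InB b × Walk G i x b) ×
              (∀ k → k < i → ∀ b → InB b → ¬ Walk G k x b)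

  Bl : ℕ → Fin n → Set
  Bl zero    x = InB x
  Bl (suc i) x = ¬ InA x × ¬ InB x × ¬ InC x × ¬ InD x × DistB x (suc i)

  InE : ℕ → Fin n × Fin n → Set
  InE i (a , b) = IsEdge G (a , b) ×
    ((Bl i a × Bl (suc i) b) ⊎ (Bl i b × Bl (suc i) a))

  Heavy : ℕ → Set
  Heavy i = Σ (Fin n × Fin n) λ e → InE i e × AtLeast 3 (InF G e)

  IsJ : ℕ∞ → Set
  IsJ (fin k) = Heavy k × (∀ i → i < k → ¬ Heavy i)
  IsJ ∞       = ∀ i → ¬ Heavy i

  InUnion : ℕ∞ → Fin n → Set
  InUnion j x = Σ ℕ λ i → 2 ≤ i × i ≤∞ j × Bl i x

data Consec {n : ℕ} : List (Fin n) → Fin n → Fin n → Set where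
  here  : ∀ {x y xs} → Consec (x ∷ y ∷ xs) x y
  there : ∀ {x y z xs} → Consec xs x y → Consec (z ∷ xs) x y

NonEmpty : {n : ℕ} → List (Fin n) → Set
NonEmpty []      = ⊥
NonEmpty (_ ∷ _) = ⊤

IsDisjointUnionOfPaths : {n : ℕ} → Graph n → (Fin n → Set) → List (List (Fin n)) → Set
IsDisjointUnionOfPaths {n} G S ps =
  All NonEmpty ps ×
  Unique (concat ps) ×
  (∀ x → (x ∈ concat ps) ⇔ S x) ×
  (∀ x y → S x → S y →
     Adj G x y ⇔ (Σ (List (Fin n)) λ P → P ∈ ps × (Consec P x y ⊎ Consec P y x)))

-- Call an edge e light if |F_e| ≤ 2; by the choice of j every edge of E_k with k < j is light.
-- Every vertex x of B_{k+1} has a neighbour in B_k: its successor y on a shortest walk to B. For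
-- k ≥ 1 the point is y ∉ D: if y ~ c ∈ C then cu, cv, cw ∈ F_{yc}, so |F_{yc}| ≤ 3 forces x ~ c,
-- which would put x into D. For adjacent y ∈ B_{k+1}, z ∈ B_k the vertex z has a neighbour r
-- not adjacent to y, so zr ∈ F_{yz}; together with yp for every neighbour p of y outside N[z],
-- lightness leaves room for only one such p. Used twice down the layers, this gives: a vertex
-- of B_i, 2 ≤ i ≤ j, has at most one neighbour in B_i ∪ B_{i+1} and at most two neighbours in
-- the union. Listing the union by increasing layer, each vertex has at most one later
-- neighbour t, and t has at most one other later neighbour, so adding the vertices from the
-- back keeps a disjoint union of paths. The lowest vertex of each path lies in B_2, and its
-- edge down to B_1 injects the paths into E_1.

module Submission where

open import Defs

open import Data.Bool using (true; false; T)
open import Data.Empty using (⊥; ⊥-elim)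
open import Data.Fin using (Fin; toℕ)
open import Data.Fin.Properties using (toℕ-injective; any?; pigeonhole; toℕ<n) renaming (_≟_ to _≟ᶠ_)
open import Data.List using (List; []; _∷_; _++_; [_]; concat; filter; allFin; length)
open import Data.List.Extrema.Nat using (argmin; argmin-sel; f[argmin]≤f[⊤]; f[argmin]≤f[xs])
open import Data.List.Membership.Propositional using (_∈_; _∉_; find; lose)
open import Data.List.Membership.Propositional.Properties
  using (∈-++⁺ˡ; ∈-++⁺ʳ; ∈-++⁻; ∈-concat⁺′; ∈-filter⁺; ∈-filter⁻; ∈-allFin)
open import Data.List.Properties using (++-assoc)
open import Data.List.Relation.Binary.Disjoint.Propositional using (Disjoint)
open import Data.List.Relation.Binary.Disjoint.Propositional.Properties using () renaming (sym to Disjoint-sym)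
open import Data.List.Relation.Binary.Permutation.Propositional using (↭-sym; ↭⇒↭ₛ)
open import Data.List.Relation.Binary.Permutation.Propositional.Properties using (∈-resp-↭)
import Data.List.Relation.Binary.Permutation.Setoid.Properties as PermutationSetoid
open import Data.List.Relation.Unary.All using (All; []; _∷_)
import Data.List.Relation.Unary.All as All
open import Data.List.Relation.Unary.All.Properties using (¬Any⇒All¬; All¬⇒¬Any)
import Data.List.Relation.Unary.All.Properties as All
open import Data.List.Relation.Unary.AllPairs using (AllPairs)
open import Data.List.Relation.Unary.Any using (Any; here; there; toSum; fromSum)
open import Data.List.Relation.Unary.Linked.Properties using (Linked⇒AllPairs)
open import Data.List.Relation.Unary.Unique.Propositional using (Unique; []; _∷_)
import Data.List.Relation.Unary.Unique.Propositional.Properties as Unique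
import Data.List.Sort
open import Data.Nat using (ℕ; zero; suc; _+_; _≤_; _<_; z≤n; s≤s; _≤?_)
import Data.Nat as ℕ
open import Data.Nat.Properties
  using ( ≤-refl; ≤-reflexive; ≤-trans; ≤-pred; n≤1+n; n<1+n; m<n⇒m<1+n; ≤∧≢⇒<; ≮⇒≥; <⇒≢; <⇒≱; ≰⇒>
        ; m≤n⇒m<n∨m≡n; <-cmp; ≤-decTotalOrder; anyUpTo?)
open import Data.Product using (Σ; ∃; _×_; _,_; proj₁; proj₂)
open import Data.Sum using (_⊎_; inj₁; inj₂)
import Data.Sum
open import Data.Unit using (⊤; tt)
open import Function using (id; _∘_)
open import Function.Bundles using (_⇔_; mk⇔; Equivalence)
open import Relation.Binary.Definitions using (tri<; tri≈; tri>)
import Relation.Binary.Construct.On as On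
open import Relation.Binary.PropositionalEquality using (_≡_; _≢_; refl; sym; trans; cong; subst; setoid)
open import Relation.Nullary using (¬_; Dec; yes; no)
open import Relation.Nullary.Decidable using (T?; _×-dec_; _⊎-dec_; ¬?)
import Relation.Nullary.Decidable as Dec

module ⇔ = Equivalence

private
  variable
    n : ℕ
    A : Set
    x y m t : A
    xs ys zs : List A

unique-++⁻ˡ : ∀ xs → Unique (xs ++ ys) → Unique xs
unique-++⁻ˡ []       _         = []
unique-++⁻ˡ (x ∷ xs) (x∉ ∷ u) = All.++⁻ˡ xs x∉ ∷ unique-++⁻ˡ xs u

unique-++⁻ʳ : ∀ xs → Unique (xs ++ ys) → Unique ys
unique-++⁻ʳ []       u       = u
unique-++⁻ʳ (x ∷ xs) (_ ∷ u) = unique-++⁻ʳ xs u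

unique-++⁻-disjoint : ∀ xs → Unique (xs ++ ys) → Disjoint xs ys
unique-++⁻-disjoint (x ∷ xs) (x∉ ∷ _) (here refl , y∈) = All¬⇒¬Any (All.++⁻ʳ xs x∉) y∈
unique-++⁻-disjoint (x ∷ xs) (_ ∷ u)  (there x∈ , y∈) = unique-++⁻-disjoint xs u (x∈ , y∈)

concat-unique⇒≡ : ∀ {xss : List (List A)} {xs ys} → Unique (concat xss) → xs ∈ xss → ys ∈ xss →
                   x ∈ xs → x ∈ ys → xs ≡ ys
concat-unique⇒≡ {xss = xs ∷ _} _ (here refl) (here refl) _ _ = refl
concat-unique⇒≡ {xss = xs ∷ _} u (here refl) (there ys∈) x∈xs x∈ys =
  ⊥-elim (unique-++⁻-disjoint xs u (x∈xs , ∈-concat⁺′ x∈ys ys∈))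
concat-unique⇒≡ {xss = xs ∷ _} u (there xs∈) (here refl) x∈xs x∈ys =
  ⊥-elim (unique-++⁻-disjoint xs u (x∈ys , ∈-concat⁺′ x∈xs xs∈))
concat-unique⇒≡ {xss = xs ∷ _} u (there xs∈) (there ys∈) x∈xs x∈ys =
  concat-unique⇒≡ (unique-++⁻ʳ xs u) xs∈ ys∈ x∈xs x∈ys

∈-++-[_] : ∀ m → x ∈ xs ++ [ m ] ⇔ (x ≡ m ⊎ x ∈ xs)
∈-++-[_] {xs = xs} m = mk⇔ to (λ { (inj₁ e) → ∈-++⁺ʳ xs (here e) ; (inj₂ x∈) → ∈-++⁺ˡ x∈ })
  where
  to : x ∈ xs ++ [ m ] → x ≡ m ⊎ x ∈ xs
  to x∈ with ∈-++⁻ xs x∈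
  ... | inj₁ x∈xs       = inj₂ x∈xs
  ... | inj₂ (here e) = inj₁ e

Adds : A → List A → List A → Set
Adds m xs′ xs = ∀ {x} → x ∈ xs′ ⇔ (x ≡ m ⊎ x ∈ xs)

Adds-++ˡ : ∀ {xs′} zs → Adds m xs′ xs → Adds m (xs′ ++ zs) (xs ++ zs)
Adds-++ˡ {m = m} {xs = xs} {xs′ = xs′} zs adds = mk⇔ to from
  where
  to : x ∈ xs′ ++ zs → x ≡ m ⊎ x ∈ xs ++ zs
  to x∈ with ∈-++⁻ xs′ x∈
  ... | inj₂ x∈zs = inj₂ (∈-++⁺ʳ xs x∈zs)
  ... | inj₁ x∈xs′ with ⇔.to adds x∈xs′
  ...   | inj₁ e    = inj₁ e
  ...   | inj₂ x∈xs = inj₂ (∈-++⁺ˡ x∈xs)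
  from : x ≡ m ⊎ x ∈ xs ++ zs → x ∈ xs′ ++ zs
  from (inj₁ e) = ∈-++⁺ˡ (⇔.from adds (inj₁ e))
  from (inj₂ x∈) with ∈-++⁻ xs x∈
  ... | inj₁ x∈xs = ∈-++⁺ˡ (⇔.from adds (inj₂ x∈xs))
  ... | inj₂ x∈zs = ∈-++⁺ʳ xs′ x∈zs

Adds-++ʳ : ∀ {zs′} xs → Adds m zs′ zs → Adds m (xs ++ zs′) (xs ++ zs)
Adds-++ʳ {m = m} {zs = zs} {zs′ = zs′} xs adds = mk⇔ to from
  where
  to : x ∈ xs ++ zs′ → x ≡ m ⊎ x ∈ xs ++ zs
  to x∈ with ∈-++⁻ xs x∈
  ... | inj₁ x∈xs = inj₂ (∈-++⁺ˡ x∈xs)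
  ... | inj₂ x∈zs′ with ⇔.to adds x∈zs′
  ...   | inj₁ e    = inj₁ e
  ...   | inj₂ x∈zs = inj₂ (∈-++⁺ʳ xs x∈zs)
  from : x ≡ m ⊎ x ∈ xs ++ zs → x ∈ xs ++ zs′
  from (inj₁ e) = ∈-++⁺ʳ xs (⇔.from adds (inj₁ e))
  from (inj₂ x∈) with ∈-++⁻ xs x∈
  ... | inj₁ x∈xs = ∈-++⁺ˡ x∈xs
  ... | inj₂ x∈zs = ∈-++⁺ʳ xs (⇔.from adds (inj₂ x∈zs))

Adds⇒Disjoint : ∀ {xs′} → Adds m xs′ xs → m ∉ zs → Disjoint xs zs → Disjoint xs′ zs
Adds⇒Disjoint adds m∉ disj (x∈ , x∈zs) with ⇔.to adds x∈
... | inj₁ refl = m∉ x∈zs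
... | inj₂ x∈xs = disj (x∈xs , x∈zs)

∃-minimal : (f : Fin n → ℕ) (P : List (Fin n)) → NonEmpty P → ∃ λ r → r ∈ P × All (λ y → f r ≤ f y) P
∃-minimal f (x ∷ xs) _ =
  argmin f x xs , fromSum (argmin-sel f x xs) , f[argmin]≤f[⊤] {f = f} x xs ∷ f[argmin]≤f[xs] {f = f} x xs

_≐_ : A × A → A × A → Set
(a , b) ≐ (c , d) = (a ≡ c × b ≡ d) ⊎ (a ≡ d × b ≡ c)

≐-sym : ∀ {p q : A × A} → p ≐ q → q ≐ p
≐-sym (inj₁ (refl , refl)) = inj₁ (refl , refl)
≐-sym (inj₂ (refl , refl)) = inj₂ (refl , refl)

≐-trans : ∀ {p q r : A × A} → p ≐ q → q ≐ r → p ≐ r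
≐-trans (inj₁ (refl , refl)) qr                   = qr
≐-trans (inj₂ (refl , refl)) (inj₁ (refl , refl)) = inj₂ (refl , refl)
≐-trans (inj₂ (refl , refl)) (inj₂ (refl , refl)) = inj₁ (refl , refl)

-- Paths as vertex lists

Neighbours : List (Fin n) → Fin n → Fin n → Set
Neighbours P x y = Consec P x y ⊎ Consec P y x

Consec⇒∈ˡ : ∀ {P : List (Fin n)} → Consec P x y → x ∈ P
Consec⇒∈ˡ here      = here refl
Consec⇒∈ˡ (there c) = there (Consec⇒∈ˡ c)

Consec⇒∈ʳ : ∀ {P : List (Fin n)} → Consec P x y → y ∈ P
Consec⇒∈ʳ here      = there (here refl)
Consec⇒∈ʳ (there c) = there (Consec⇒∈ʳ c)

Neighbours⇒∈ˡ : ∀ {P : List (Fin n)} → Neighbours P x y → x ∈ P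
Neighbours⇒∈ˡ (inj₁ c) = Consec⇒∈ˡ c
Neighbours⇒∈ˡ (inj₂ c) = Consec⇒∈ʳ c

Neighbours⇒∈ʳ : ∀ {P : List (Fin n)} → Neighbours P x y → y ∈ P
Neighbours⇒∈ʳ (inj₁ c) = Consec⇒∈ʳ c
Neighbours⇒∈ʳ (inj₂ c) = Consec⇒∈ˡ c

Neighbours-there : ∀ {P : List (Fin n)} {z} → Neighbours P x y → Neighbours (z ∷ P) x y
Neighbours-there (inj₁ c) = inj₁ (there c)
Neighbours-there (inj₂ c) = inj₂ (there c)

Endpoint : Fin n → List (Fin n) → Set
Endpoint t P = ∀ {a b} → Neighbours P t a → Neighbours P t b → a ≡ b

endpoint-split : (P : List (Fin n)) → Unique P → t ∈ P → Endpoint t P →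
                 (∃ λ Q → P ≡ t ∷ Q) ⊎ (∃ λ R → P ≡ R ++ [ t ])
endpoint-split (x ∷ Q) _ (here refl) _ = inj₁ (Q , refl)
endpoint-split (x ∷ Q) (x∉ ∷ u) (there t∈) end
  with endpoint-split Q u t∈ (λ a b → end (Neighbours-there a) (Neighbours-there b))
... | inj₂ (R , refl)      = inj₂ (x ∷ R , refl)
... | inj₁ ([] , refl)     = inj₂ ([ x ] , refl)
... | inj₁ (y ∷ _ , refl) =
  ⊥-elim (All.lookup x∉ (there (here refl)) (end (inj₂ here) (inj₁ (there here))))

Consec-snoc⁺ : (R : List (Fin n)) → Consec (R ++ [ t ]) x y ⊎ (x ≡ t × y ≡ m) →
               Consec (R ++ t ∷ m ∷ []) x y
Consec-snoc⁺ []           (inj₁ (there ()))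
Consec-snoc⁺ []           (inj₂ (refl , refl)) = here
Consec-snoc⁺ (r ∷ [])     (inj₁ here)          = here
Consec-snoc⁺ (r ∷ r′ ∷ R) (inj₁ here)          = here
Consec-snoc⁺ (r ∷ R)      (inj₁ (there c))     = there (Consec-snoc⁺ R (inj₁ c))
Consec-snoc⁺ (r ∷ R)      (inj₂ e)             = there (Consec-snoc⁺ R (inj₂ e))

Consec-snoc⁻ : (R : List (Fin n)) → Consec (R ++ t ∷ m ∷ []) x y →
               Consec (R ++ [ t ]) x y ⊎ (x ≡ t × y ≡ m)
Consec-snoc⁻ []           here      = inj₂ (refl , refl)
Consec-snoc⁻ []           (there (there ()))
Consec-snoc⁻ (r ∷ [])     here      = inj₁ here
Consec-snoc⁻ (r ∷ r′ ∷ R) here      = inj₁ here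
Consec-snoc⁻ (r ∷ R)      (there c) with Consec-snoc⁻ R c
... | inj₁ c′ = inj₁ (there c′)
... | inj₂ e  = inj₂ e

record Attachment (m t : Fin n) (P P′ : List (Fin n)) : Set where
  field
    nonEmpty   : NonEmpty P′
    unique     : Unique P′
    members    : Adds m P′ P
    neighbours : ∀ {x y} → Neighbours P′ x y ⇔ (Neighbours P x y ⊎ (x , y) ≐ (m , t))

attach-head : (Q : List (Fin n)) → Unique (t ∷ Q) → m ∉ t ∷ Q → Attachment m t (t ∷ Q) (m ∷ t ∷ Q)
attach-head Q u m∉ = record
  { nonEmpty   = tt
  ; unique     = ¬Any⇒All¬ _ m∉ ∷ u
  ; members    = mk⇔ toSum fromSum
  ; neighbours = mk⇔ to from
  }
  where
  to : Neighbours (m ∷ t ∷ Q) x y → Neighbours (t ∷ Q) x y ⊎ (x , y) ≐ (m , t)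
  to (inj₁ here)      = inj₂ (inj₁ (refl , refl))
  to (inj₂ here)      = inj₂ (inj₂ (refl , refl))
  to (inj₁ (there c)) = inj₁ (inj₁ c)
  to (inj₂ (there c)) = inj₁ (inj₂ c)
  from : Neighbours (t ∷ Q) x y ⊎ (x , y) ≐ (m , t) → Neighbours (m ∷ t ∷ Q) x y
  from (inj₁ nb)                 = Neighbours-there nb
  from (inj₂ (inj₁ (refl , refl))) = inj₁ here
  from (inj₂ (inj₂ (refl , refl))) = inj₂ here

attach-last : (R : List (Fin n)) → Unique (R ++ [ t ]) → m ∉ R ++ [ t ] →
              Attachment m t (R ++ [ t ]) (R ++ t ∷ m ∷ [])
attach-last {t = t} {m = m} R u m∉ = record
  { nonEmpty   = nonEmpty R
  ; unique     = subst Unique (++-assoc R [ t ] [ m ])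
                   (Unique.++⁺ u ([] ∷ []) λ { (x∈ , here refl) → m∉ x∈ })
  ; members    = λ {x} → subst (λ P′ → x ∈ P′ ⇔ (x ≡ m ⊎ x ∈ R ++ [ t ]))
                                (++-assoc R [ t ] [ m ]) ∈-++-[ m ]
  ; neighbours = mk⇔ to from
  }
  where
  nonEmpty : ∀ R → NonEmpty (R ++ t ∷ m ∷ [])
  nonEmpty []      = tt
  nonEmpty (_ ∷ _) = tt
  to : Neighbours (R ++ t ∷ m ∷ []) x y → Neighbours (R ++ [ t ]) x y ⊎ (x , y) ≐ (m , t)
  to (inj₁ c) with Consec-snoc⁻ R c
  ... | inj₁ c′          = inj₁ (inj₁ c′)
  ... | inj₂ (refl , refl) = inj₂ (inj₂ (refl , refl))
  to (inj₂ c) with Consec-snoc⁻ R c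
  ... | inj₁ c′          = inj₁ (inj₂ c′)
  ... | inj₂ (refl , refl) = inj₂ (inj₁ (refl , refl))
  from : Neighbours (R ++ [ t ]) x y ⊎ (x , y) ≐ (m , t) → Neighbours (R ++ t ∷ m ∷ []) x y
  from (inj₁ (inj₁ c))             = inj₁ (Consec-snoc⁺ R (inj₁ c))
  from (inj₁ (inj₂ c))             = inj₂ (Consec-snoc⁺ R (inj₁ c))
  from (inj₂ (inj₁ (refl , refl))) = inj₂ (Consec-snoc⁺ R (inj₂ (refl , refl)))
  from (inj₂ (inj₂ (refl , refl))) = inj₁ (Consec-snoc⁺ R (inj₂ (refl , refl)))

attach-path : (P : List (Fin n)) → Unique P → t ∈ P → Endpoint t P → m ∉ P → ∃ (Attachment m t P)
attach-path P u t∈ end m∉ with endpoint-split P u t∈ end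
... | inj₁ (Q , refl) = _ , attach-head Q u m∉
... | inj₂ (R , refl) = _ , attach-last R u m∉

Linked : List (List (Fin n)) → Fin n → Fin n → Set
Linked ps x y = Any (λ P → Neighbours P x y) ps

record Attachmentᶠ (m t : Fin n) (ps ps′ : List (List (Fin n))) : Set where
  field
    nonEmpty : All NonEmpty ps′
    unique   : Unique (concat ps′)
    members  : Adds m (concat ps′) (concat ps)
    linked   : ∀ {x y} → Linked ps′ x y ⇔ (Linked ps x y ⊎ (x , y) ≐ (m , t))

attach-here : ∀ {P P′ ps} → Attachment m t P P′ → All NonEmpty ps → Unique (P ++ concat ps) →
              m ∉ P ++ concat ps → Attachmentᶠ m t (P ∷ ps) (P′ ∷ ps)
attach-here {m = m} {t = t} {P} {P′} {ps} attachment ne u m∉ = record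
  { nonEmpty = nonEmpty ∷ ne
  ; unique   = Unique.++⁺ unique (unique-++⁻ʳ P u)
                 (Adds⇒Disjoint members (λ m∈ → m∉ (∈-++⁺ʳ P m∈)) (unique-++⁻-disjoint P u))
  ; members  = Adds-++ˡ (concat ps) members
  ; linked   = mk⇔ to from
  }
  where
  open Attachment attachment
  to : Linked (P′ ∷ ps) x y → Linked (P ∷ ps) x y ⊎ (x , y) ≐ (m , t)
  to (here nb) with ⇔.to neighbours nb
  ... | inj₁ nb′ = inj₁ (here nb′)
  ... | inj₂ e   = inj₂ e
  to (there l) = inj₁ (there l)
  from : Linked (P ∷ ps) x y ⊎ (x , y) ≐ (m , t) → Linked (P′ ∷ ps) x y
  from (inj₁ (here nb)) = here (⇔.from neighbours (inj₁ nb))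
  from (inj₁ (there l)) = there l
  from (inj₂ e)         = here (⇔.from neighbours (inj₂ e))

attach-there : ∀ {P ps ps′} → Attachmentᶠ m t ps ps′ → NonEmpty P → Unique (P ++ concat ps) →
               m ∉ P ++ concat ps → Attachmentᶠ m t (P ∷ ps) (P ∷ ps′)
attach-there {m = m} {t = t} {P} {ps} {ps′} attachment neP u m∉ = record
  { nonEmpty = neP ∷ nonEmpty
  ; unique   = Unique.++⁺ (unique-++⁻ˡ P u) unique
                 (Disjoint-sym (Adds⇒Disjoint members (λ m∈ → m∉ (∈-++⁺ˡ m∈))
                                 (Disjoint-sym (unique-++⁻-disjoint P u))))
  ; members  = Adds-++ʳ P members
  ; linked   = mk⇔ to from
  }
  where
  open Attachmentᶠ attachment
  to : Linked (P ∷ ps′) x y → Linked (P ∷ ps) x y ⊎ (x , y) ≐ (m , t)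
  to (here nb) = inj₁ (here nb)
  to (there l) with ⇔.to linked l
  ... | inj₁ l′ = inj₁ (there l′)
  ... | inj₂ e  = inj₂ e
  from : Linked (P ∷ ps) x y ⊎ (x , y) ≐ (m , t) → Linked (P ∷ ps′) x y
  from (inj₁ (here nb)) = here nb
  from (inj₁ (there l)) = there (⇔.from linked (inj₁ l))
  from (inj₂ e)         = there (⇔.from linked (inj₂ e))

attach : (ps : List (List (Fin n))) → All NonEmpty ps → Unique (concat ps) →
         t ∈ concat ps → m ∉ concat ps → (∀ {P} → P ∈ ps → t ∈ P → Endpoint t P) →
         ∃ (Attachmentᶠ m t ps)
attach (P ∷ ps) (neP ∷ ne) u t∈ m∉ end with ∈-++⁻ P t∈
... | inj₁ t∈P =
  let _ , attachment = attach-path P (unique-++⁻ˡ P u) t∈P (end (here refl) t∈P) (m∉ ∘ ∈-++⁺ˡ)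
  in  _ , attach-here attachment ne u m∉
... | inj₂ t∈ps =
  let _ , attachment = attach ps ne (unique-++⁻ʳ P u) t∈ps (m∉ ∘ ∈-++⁺ʳ P) (end ∘ there)
  in  _ , attach-there attachment neP u m∉

module GraphProperties {n : ℕ} (G : Graph n) where

  Adj-sym : ∀ {x y} → Adj G x y → Adj G y x
  Adj-sym {x} {y} = subst T (adj-sym G x y)

  Adj-irrefl : ∀ {x} → ¬ Adj G x x
  Adj-irrefl {x} = subst T (adj-irr G x)

  Adj⇒≢ : ∀ {x y} → Adj G x y → x ≢ y
  Adj⇒≢ a refl = Adj-irrefl a

  Adj? : ∀ x y → Dec (Adj G x y)
  Adj? x y = T? (adj G x y)

  Walk? : ∀ k x y → Dec (Walk G k x y)
  Walk? zero x y with x ≟ᶠ y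
  ... | yes refl = yes nil
  ... | no x≢y   = no λ { nil → x≢y refl }
  Walk? (suc k) x y =
    Dec.map′ (λ (z , xz , wk) → cons xz wk) (λ { (cons xz wk) → _ , xz , wk })
             (any? λ z → Adj? x z ×-dec Walk? k z y)

module PathCovers {n : ℕ} (G : Graph n) where
  open GraphProperties G

  record PathCover (xs : List (Fin n)) (ps : List (List (Fin n))) : Set where
    field
      nonEmpty    : All NonEmpty ps
      unique      : Unique (concat ps)
      members     : ∀ {x} → x ∈ concat ps ⇔ x ∈ xs
      adj⇒linked  : ∀ {x y} → x ∈ xs → y ∈ xs → Adj G x y → Linked ps x y
      linked⇒adj  : ∀ {x y} → Linked ps x y → Adj G x y

  PathCover⇒IsDisjointUnionOfPaths : ∀ {S xs ps} → (∀ {x} → x ∈ xs ⇔ S x) → PathCover xs ps →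
                                     IsDisjointUnionOfPaths G S ps
  PathCover⇒IsDisjointUnionOfPaths xs⇔S cover =
    nonEmpty , unique , (λ _ → mk⇔ (⇔.to xs⇔S ∘ ⇔.to members) (⇔.from members ∘ ⇔.from xs⇔S)) ,
    λ _ _ x∈ y∈ → mk⇔ (λ a → find (adj⇒linked (⇔.from xs⇔S x∈) (⇔.from xs⇔S y∈) a))
                      (λ (_ , P∈ , nb) → linked⇒adj (lose P∈ nb))
    where open PathCover cover

  AtMostOneNeighbourIn : Fin n → List (Fin n) → Set
  AtMostOneNeighbourIn x xs = ∀ {y y′} → y ∈ xs → y′ ∈ xs → Adj G x y → Adj G x y′ → y ≡ y′

  -- Prepending m to a disjoint union of paths on xs gives one again: m receives at most one
  -- edge, towards a vertex t that is still an endpoint of its path.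
  Attachable : Fin n → List (Fin n) → Set
  Attachable m xs = AtMostOneNeighbourIn m xs × (∀ {t} → t ∈ xs → Adj G m t → AtMostOneNeighbourIn t xs)

  PathOrdered : List (Fin n) → Set
  PathOrdered []       = ⊤
  PathOrdered (m ∷ xs) = Attachable m xs × PathOrdered xs

  cover-isolated : ∀ {m xs ps} → m ∉ xs → (∀ {y} → y ∈ xs → ¬ Adj G m y) →
                   PathCover xs ps → PathCover (m ∷ xs) ([ m ] ∷ ps)
  cover-isolated {m} {xs} {ps} m∉ isolated cover = record
    { nonEmpty   = tt ∷ nonEmpty
    ; unique     = ¬Any⇒All¬ _ (λ m∈ → m∉ (⇔.to members m∈)) ∷ unique
    ; members    = mk⇔ (λ { (here e) → here e ; (there x∈) → there (⇔.to members x∈) })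
                       (λ { (here e) → here e ; (there x∈) → there (⇔.from members x∈) })
    ; adj⇒linked = adj⇒linked′
    ; linked⇒adj = λ { (here (inj₁ (there ()))) ; (here (inj₂ (there ()))) ; (there l) → linked⇒adj l }
    }
    where
    open PathCover cover
    adj⇒linked′ : ∀ {x y} → x ∈ m ∷ xs → y ∈ m ∷ xs → Adj G x y → Linked ([ m ] ∷ ps) x y
    adj⇒linked′ (here refl) (here refl) a = ⊥-elim (Adj-irrefl a)
    adj⇒linked′ (here refl) (there y∈)  a = ⊥-elim (isolated y∈ a)
    adj⇒linked′ (there x∈)  (here refl) a = ⊥-elim (isolated x∈ (Adj-sym a))
    adj⇒linked′ (there x∈)  (there y∈)  a = there (adj⇒linked x∈ y∈ a)

  cover-endpoint : ∀ {xs ps t P} → PathCover xs ps → t ∈ xs → AtMostOneNeighbourIn t xs →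
                   P ∈ ps → Endpoint t P
  cover-endpoint {xs} {t = t} {P} cover t∈ unique-t P∈ nb nb′ =
    unique-t (in-xs nb) (in-xs nb′) (linked⇒adj (lose P∈ nb)) (linked⇒adj (lose P∈ nb′))
    where
    open PathCover cover
    in-xs : ∀ {a} → Neighbours P t a → a ∈ xs
    in-xs nb = ⇔.to members (∈-concat⁺′ (Neighbours⇒∈ʳ nb) P∈)

  cover-attached : ∀ {m t xs ps ps′} → AtMostOneNeighbourIn m xs → t ∈ xs → Adj G m t →
                   PathCover xs ps → Attachmentᶠ m t ps ps′ → PathCover (m ∷ xs) ps′
  cover-attached {m} {t} {xs} {ps} {ps′} unique-m t∈ mt cover attachment = record
    { nonEmpty   = A.nonEmpty
    ; unique     = A.unique
    ; members    = mk⇔ (λ x∈ → fromSum (Data.Sum.map id (⇔.to members) (⇔.to A.members x∈)))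
                       (λ x∈ → ⇔.from A.members (Data.Sum.map id (⇔.from members) (toSum x∈)))
    ; adj⇒linked = adj⇒linked′
    ; linked⇒adj = linked⇒adj′
    }
    where
    open PathCover cover
    module A = Attachmentᶠ attachment
    adj⇒linked′ : ∀ {x y} → x ∈ m ∷ xs → y ∈ m ∷ xs → Adj G x y → Linked ps′ x y
    adj⇒linked′ (here refl) (here refl) a = ⊥-elim (Adj-irrefl a)
    adj⇒linked′ (here refl) (there y∈)  a with unique-m y∈ t∈ a mt
    ... | refl = ⇔.from A.linked (inj₂ (inj₁ (refl , refl)))
    adj⇒linked′ (there x∈)  (here refl) a with unique-m x∈ t∈ (Adj-sym a) mt
    ... | refl = ⇔.from A.linked (inj₂ (inj₂ (refl , refl)))
    adj⇒linked′ (there x∈)  (there y∈)  a = ⇔.from A.linked (inj₁ (adj⇒linked x∈ y∈ a))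
    linked⇒adj′ : ∀ {x y} → Linked ps′ x y → Adj G x y
    linked⇒adj′ l with ⇔.to A.linked l
    ... | inj₁ l′                   = linked⇒adj l′
    ... | inj₂ (inj₁ (refl , refl)) = mt
    ... | inj₂ (inj₂ (refl , refl)) = Adj-sym mt

  first-neighbour : ∀ m (xs : List (Fin n)) → (∃ λ t → t ∈ xs × Adj G m t) ⊎ (∀ {y} → y ∈ xs → ¬ Adj G m y)
  first-neighbour m [] = inj₂ λ ()
  first-neighbour m (x ∷ xs) with Adj? m x | first-neighbour m xs
  ... | yes a | _                   = inj₁ (x , here refl , a)
  ... | no _  | inj₁ (t , t∈ , a)   = inj₁ (t , there t∈ , a)
  ... | no ¬a | inj₂ isolated       = inj₂ λ { (here refl) → ¬a ; (there y∈) → isolated y∈ }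

  pathCover : ∀ xs → Unique xs → PathOrdered xs → ∃ (PathCover xs)
  pathCover [] _ _ = [] , record
    { nonEmpty = [] ; unique = [] ; members = mk⇔ (λ ()) (λ ()) ; adj⇒linked = λ () ; linked⇒adj = λ () }
  pathCover (m ∷ xs) (m∉ ∷ u) (attachable , ordered) with pathCover xs u ordered | first-neighbour m xs
  ... | ps , cover | inj₂ isolated      = _ , cover-isolated (All¬⇒¬Any m∉) isolated cover
  ... | ps , cover | inj₁ (t , t∈ , mt) =
    let open PathCover cover
        ps′ , attachment = attach ps nonEmpty unique (⇔.from members t∈) (All¬⇒¬Any m∉ ∘ ⇔.to members)
                             (λ P∈ _ → cover-endpoint cover t∈ (proj₂ attachable t∈ mt) P∈)
    in  ps′ , cover-attached (proj₁ attachable) t∈ mt cover attachment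

_≤∞?_ : ∀ i j → Dec (i ≤∞ j)
i ≤∞? fin k = i ≤? k
i ≤∞? ∞     = yes tt

≤∞-pred : ∀ {i j} → suc i ≤∞ j → i ≤∞ j
≤∞-pred {i} {fin _} 1+i≤j = ≤-trans (n≤1+n i) 1+i≤j
≤∞-pred {j = ∞}     _     = tt

-- Edges and the sets F_e

module EdgeProperties {n : ℕ} (G : Graph n) where
  open GraphProperties G

  edge : Fin n → Fin n → Fin n × Fin n
  edge a b with toℕ a ℕ.<? toℕ b
  ... | yes _ = a , b
  ... | no _  = b , a

  edge-≐ : ∀ a b → edge a b ≐ (a , b)
  edge-≐ a b with toℕ a ℕ.<? toℕ b
  ... | yes _ = inj₁ (refl , refl)
  ... | no _  = inj₂ (refl , refl)

  edge-injective : ∀ {a b c d} → edge a b ≡ edge c d → (a , b) ≐ (c , d)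
  edge-injective {a} {b} {c} {d} same =
    ≐-trans (≐-sym (edge-≐ a b)) (subst (_≐ (c , d)) (sym same) (edge-≐ c d))

  edge-IsEdge : ∀ {a b} → Adj G a b → IsEdge G (edge a b)
  edge-IsEdge {a} {b} ab with toℕ a ℕ.<? toℕ b
  ... | yes a<b = a<b , ab
  ... | no a≮b  = ≤∧≢⇒< (≮⇒≥ a≮b) (Adj⇒≢ ab ∘ toℕ-injective ∘ sym) , Adj-sym ab

  Ends : Fin n × Fin n → Fin n → Set
  Ends (a , b) t = t ≡ a ⊎ t ≡ b

  Ends-≐ : ∀ {p q t} → p ≐ q → Ends p t → Ends q t
  Ends-≐ (inj₁ (refl , refl)) = id
  Ends-≐ (inj₂ (refl , refl)) = Data.Sum.swap

  VV⇔ : ∀ {e e′ t} → VV G e e′ t ⇔ (Ends e t ⊎ Ends e′ t)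
  VV⇔ = mk⇔ split join
    where
    split : ∀ {e e′ t} → VV G e e′ t → Ends e t ⊎ Ends e′ t
    split (inj₁ p)        = inj₁ (inj₁ p)
    split (inj₂ (inj₁ p)) = inj₁ (inj₂ p)
    split (inj₂ (inj₂ p)) = inj₂ p
    join : ∀ {e e′ t} → Ends e t ⊎ Ends e′ t → VV G e e′ t
    join (inj₁ (inj₁ p)) = inj₁ p
    join (inj₁ (inj₂ p)) = inj₂ (inj₁ p)
    join (inj₂ p)        = inj₂ (inj₂ p)

  InF-P3 : ∀ {e e′ x y z} → e ≐ (x , y) → e′ ≐ (y , z) → IsEdge G e′ →
           Adj G x y → Adj G y z → x ≢ z → ¬ Adj G x z → InF G e e′
  InF-P3 {x = x} {y} {z} e≐ e′≐ e′-edge xy yz x≢z ¬xz =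
    e′-edge , x , y , z , Adj⇒≢ xy , Adj⇒≢ yz , x≢z ,
    (λ t → mk⇔ (to ∘ Data.Sum.map (Ends-≐ e≐) (Ends-≐ e′≐) ∘ ⇔.to VV⇔)
               (⇔.from VV⇔ ∘ Data.Sum.map (Ends-≐ (≐-sym e≐)) (Ends-≐ (≐-sym e′≐)) ∘ from)) ,
    xy , yz , ¬xz
    where
    to : ∀ {t} → Ends (x , y) t ⊎ Ends (y , z) t → t ≡ x ⊎ t ≡ y ⊎ t ≡ z
    to (inj₁ (inj₁ p)) = inj₁ p
    to (inj₁ (inj₂ p)) = inj₂ (inj₁ p)
    to (inj₂ (inj₁ p)) = inj₂ (inj₁ p)
    to (inj₂ (inj₂ p)) = inj₂ (inj₂ p)
    from : ∀ {t} → t ≡ x ⊎ t ≡ y ⊎ t ≡ z → Ends (x , y) t ⊎ Ends (y , z) t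
    from (inj₁ p)        = inj₁ (inj₁ p)
    from (inj₂ (inj₁ p)) = inj₁ (inj₂ p)
    from (inj₂ (inj₂ p)) = inj₂ (inj₂ p)

  InF-pivotʳ : ∀ {x y z} → Adj G x y → Adj G y z → x ≢ z → ¬ Adj G x z → InF G (edge x y) (edge y z)
  InF-pivotʳ {x} {y} {z} xy yz = InF-P3 (edge-≐ x y) (edge-≐ y z) (edge-IsEdge yz) xy yz

  InF-pivotˡ : ∀ {x y z} → Adj G x y → Adj G y z → x ≢ z → ¬ Adj G x z → InF G (edge y x) (edge y z)
  InF-pivotˡ {x} {y} {z} xy yz =
    InF-P3 (≐-trans (edge-≐ y x) (inj₂ (refl , refl))) (edge-≐ y z) (edge-IsEdge yz) xy yz

-- The layers B_i

module LayerProperties {n : ℕ} (G : Graph n) (u v w : Fin n) where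
  open Layers G u v w
  open GraphProperties G

  nA-cases : ∀ x → nA x ≡ 0 ⊎ nA x ≡ 1 ⊎ nA x ≡ 2 ⊎ nA x ≡ 3
  nA-cases x with adj G x u | adj G x v | adj G x w
  ... | false | false | false = inj₁ refl
  ... | false | false | true  = inj₂ (inj₁ refl)
  ... | false | true  | false = inj₂ (inj₁ refl)
  ... | true  | false | false = inj₂ (inj₁ refl)
  ... | false | true  | true  = inj₂ (inj₂ (inj₁ refl))
  ... | true  | false | true  = inj₂ (inj₂ (inj₁ refl))
  ... | true  | true  | false = inj₂ (inj₂ (inj₁ refl))
  ... | true  | true  | true  = inj₂ (inj₂ (inj₂ refl))

  InC⇒Adj : ∀ {c} → InC c → Adj G c u × Adj G c v × Adj G c w
  InC⇒Adj {c} e with adj G c u | adj G c v | adj G c w | e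
  ... | true  | true  | true  | _ = tt , tt , tt
  ... | false | false | false | ()
  ... | false | false | true  | ()
  ... | false | true  | false | ()
  ... | true  | false | false | ()
  ... | false | true  | true  | ()
  ... | true  | false | true  | ()
  ... | true  | true  | false | ()

  InB⇒neighbourInA : ∀ {x} → InB x → ∃ λ a → InA a × Adj G x a
  InB⇒neighbourInA {x} (_ , nA≢0) with adj G x u in xu | adj G x v in xv | adj G x w in xw | nA≢0
  ... | true  | _     | _     | _ = u , inj₁ refl , subst T (sym xu) tt
  ... | false | true  | _     | _ = v , inj₂ (inj₁ refl) , subst T (sym xv) tt
  ... | false | false | true  | _ = w , inj₂ (inj₂ refl) , subst T (sym xw) tt
  ... | false | false | false | inj₁ ()
  ... | false | false | false | inj₂ ()

  Outside : Fin n → Set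
  Outside x = ¬ InA x × ¬ InB x × ¬ InC x

  Outside⇒nA≡0 : ∀ {x} → Outside x → nA x ≡ 0
  Outside⇒nA≡0 {x} (∉A , ∉B , ∉C) with nA-cases x
  ... | inj₁ e                 = e
  ... | inj₂ (inj₁ e)          = ⊥-elim (∉B (∉A , inj₁ e))
  ... | inj₂ (inj₂ (inj₁ e))   = ⊥-elim (∉B (∉A , inj₂ e))
  ... | inj₂ (inj₂ (inj₂ e))   = ⊥-elim (∉C e)

  nA≡0⇒¬Adj : ∀ {x} → nA x ≡ 0 → ¬ Adj G x u × ¬ Adj G x v × ¬ Adj G x w
  nA≡0⇒¬Adj {x} e with adj G x u | adj G x v | adj G x w | e
  ... | false | false | false | _  = (λ ()) , (λ ()) , (λ ())
  ... | true  | _     | _     | ()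
  ... | false | true  | _     | ()
  ... | false | false | true  | ()

  Outside⇒¬Adj : ∀ {x a} → Outside x → InA a → ¬ Adj G x a
  Outside⇒¬Adj out (inj₁ refl)        = proj₁ (nA≡0⇒¬Adj (Outside⇒nA≡0 out))
  Outside⇒¬Adj out (inj₂ (inj₁ refl)) = proj₁ (proj₂ (nA≡0⇒¬Adj (Outside⇒nA≡0 out)))
  Outside⇒¬Adj out (inj₂ (inj₂ refl)) = proj₂ (proj₂ (nA≡0⇒¬Adj (Outside⇒nA≡0 out)))

  InA? : ∀ x → Dec (InA x)
  InA? x = (x ≟ᶠ u) ⊎-dec (x ≟ᶠ v) ⊎-dec (x ≟ᶠ w)

  InB? : ∀ x → Dec (InB x)
  InB? x = ¬? (InA? x) ×-dec (nA x ℕ.≟ 1 ⊎-dec nA x ℕ.≟ 2)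

  InC? : ∀ x → Dec (InC x)
  InC? x = nA x ℕ.≟ 3

  InD? : ∀ x → Dec (InD x)
  InD? x = ¬? (InA? x) ×-dec ¬? (InB? x) ×-dec ¬? (InC? x) ×-dec any? (λ c → InC? c ×-dec Adj? x c)

  ReachesB : ℕ → Fin n → Set
  ReachesB k x = ∃ λ b → InB b × Walk G k x b

  ReachesB? : ∀ k x → Dec (ReachesB k x)
  ReachesB? k x = any? λ b → InB? b ×-dec Walk? k x b

  DistB? : ∀ x i → Dec (DistB x i)
  DistB? x i =
    Dec.map′ (λ (reach , ¬closer) → reach , λ k k<i b b∈B wk → ¬closer (k , k<i , b , b∈B , wk))
             (λ (reach , minimal) → reach , λ (k , k<i , b , b∈B , wk) → minimal k k<i b b∈B wk)
             (ReachesB? i x ×-dec ¬? (anyUpTo? (λ k → ReachesB? k x) i))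

  Bl? : ∀ i x → Dec (Bl i x)
  Bl? zero    x = InB? x
  Bl? (suc i) x = ¬? (InA? x) ×-dec ¬? (InB? x) ×-dec ¬? (InC? x) ×-dec ¬? (InD? x) ×-dec DistB? x (suc i)

  DistB-unique : ∀ {x i k} → DistB x i → DistB x k → i ≡ k
  DistB-unique {i = i} {k} ((b , b∈B , wi) , minimalᵢ) ((b′ , b′∈B , wk) , minimalₖ) with <-cmp i k
  ... | tri< i<k _ _ = ⊥-elim (minimalₖ i i<k b b∈B wi)
  ... | tri≈ _ i≡k _ = i≡k
  ... | tri> _ _ k<i = ⊥-elim (minimalᵢ k k<i b′ b′∈B wk)

  DistB-pred : ∀ {x i} → DistB x (suc i) → ∃ λ y → Adj G x y × DistB y i
  DistB-pred ((b , b∈B , cons xy wk) , minimal) =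
    _ , xy , (b , b∈B , wk) , λ k k<i b′ b′∈B wk′ → minimal (suc k) (s≤s k<i) b′ b′∈B (cons xy wk′)

  DistB-Adj : ∀ {x y i k} → DistB x i → Adj G x y → DistB y k → k ≤ suc i
  DistB-Adj {i = i} {k} ((b , b∈B , wk) , _) xy (_ , minimal) with k ≤? suc i
  ... | yes k≤1+i = k≤1+i
  ... | no k≰1+i  = ⊥-elim (minimal (suc i) (≰⇒> k≰1+i) b b∈B (cons (Adj-sym xy) wk))

  DistB<n : ∀ {x i} → DistB x i → i < n
  DistB<n {x} {i} dist with n ≤? i
  ... | no n≰i  = ≰⇒> n≰i
  ... | yes n≤i =
    let a , b , a<b , same = pigeonhole (s≤s n≤i) (proj₁ ∘ at)
    in  ⊥-elim (<⇒≢ a<b (DistB-unique (proj₂ (at a))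
                                      (subst (λ z → DistB z (toℕ b)) (sym same) (proj₂ (at b)))))
    where
    descend : ∀ {y} i → DistB y i → ∀ t → t ≤ i → ∃ λ z → DistB z t
    descend {y} i dist t t≤i with m≤n⇒m<n∨m≡n t≤i
    ... | inj₂ refl = y , dist
    descend (suc i) dist t _ | inj₁ t<1+i =
      let z , _ , dist′ = DistB-pred dist in descend i dist′ t (≤-pred t<1+i)
    at : (a : Fin (suc i)) → ∃ λ z → DistB z (toℕ a)
    at a = descend i dist (toℕ a) (≤-pred (toℕ<n a))

  Bl⇒DistB : ∀ {i x} → Bl i x → DistB x i
  Bl⇒DistB {zero}  {x} x∈B = (x , x∈B , nil) , λ _ ()
  Bl⇒DistB {suc i} (_ , _ , _ , _ , dist) = dist

  Bl-unique : ∀ {i k x} → Bl i x → Bl k x → i ≡ k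
  Bl-unique x∈Bᵢ x∈Bₖ = DistB-unique (Bl⇒DistB x∈Bᵢ) (Bl⇒DistB x∈Bₖ)

  Bl⇒≢ : ∀ {i k x y} → Bl i x → Bl k y → i ≢ k → x ≢ y
  Bl⇒≢ x∈Bᵢ y∈Bₖ i≢k refl = i≢k (Bl-unique x∈Bᵢ y∈Bₖ)

  Bl-Adj : ∀ {i k x y} → Bl i x → Bl k y → Adj G x y → k ≤ suc i
  Bl-Adj x∈Bᵢ y∈Bₖ xy = DistB-Adj (Bl⇒DistB x∈Bᵢ) xy (Bl⇒DistB y∈Bₖ)

  Bl-¬Adj : ∀ {i k x y} → Bl i x → Bl k y → suc i < k → ¬ Adj G x y
  Bl-¬Adj x∈Bᵢ y∈Bₖ 1+i<k xy = <⇒≱ 1+i<k (Bl-Adj x∈Bᵢ y∈Bₖ xy)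

  Bl-Adj-cases : ∀ {i k x y} → Bl i x → Bl k y → Adj G x y → suc k ≡ i ⊎ k ≡ i ⊎ k ≡ suc i
  Bl-Adj-cases x∈Bᵢ y∈Bₖ xy = cases (Bl-Adj x∈Bᵢ y∈Bₖ xy) (Bl-Adj y∈Bₖ x∈Bᵢ (Adj-sym xy))
    where
    cases : ∀ {i k} → k ≤ suc i → i ≤ suc k → suc k ≡ i ⊎ k ≡ i ⊎ k ≡ suc i
    cases {zero}        {zero}        _         _         = inj₂ (inj₁ refl)
    cases {zero}        {suc zero}    _         _         = inj₂ (inj₂ refl)
    cases {suc zero}    {zero}        _         _         = inj₁ refl
    cases {suc i}       {suc k}       (s≤s k≤) (s≤s i≤) =
      Data.Sum.map (cong suc) (Data.Sum.map (cong suc) (cong suc)) (cases k≤ i≤)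
    cases {zero}        {suc (suc k)} (s≤s ())  _
    cases {suc (suc i)} {zero}        _         (s≤s ())

  layer : Fin n → ℕ
  layer x with anyUpTo? (λ i → Bl? i x) n
  ... | yes (i , _ , _) = i
  ... | no _            = 0   -- junk: every vertex lying in some layer has it below n

  layer-correct : ∀ {i x} → Bl i x → layer x ≡ i
  layer-correct {i} {x} x∈Bᵢ with anyUpTo? (λ i → Bl? i x) n
  ... | yes (k , _ , x∈Bₖ) = Bl-unique x∈Bₖ x∈Bᵢ
  ... | no none            = ⊥-elim (none (i , DistB<n (Bl⇒DistB x∈Bᵢ) , x∈Bᵢ))

  Bl⇒layer< : ∀ {i x y} → Bl i y → Bl (suc i) x → layer y < layer x
  Bl⇒layer< {i} y∈ x∈ = ≤-reflexive (trans (cong suc (layer-correct {i} y∈)) (sym (layer-correct {suc i} x∈)))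

  IsJ⇒¬Heavy : ∀ {j k} → IsJ j → suc k ≤∞ j → ¬ Heavy k
  IsJ⇒¬Heavy {fin _} (_ , below) k<j = below _ k<j
  IsJ⇒¬Heavy {∞}     none        _   = none _

  InUnion? : ∀ j x → Dec (InUnion j x)
  InUnion? j x =
    Dec.map′ (λ (i , _ , x∈) → i , x∈) (λ (i , x∈) → i , DistB<n (Bl⇒DistB (proj₂ (proj₂ x∈))) , x∈)
             (anyUpTo? (λ i → 2 ≤? i ×-dec i ≤∞? j ×-dec Bl? i x) n)

-- The layers up to j

module LayerSort {n : ℕ} (layer : Fin n → ℕ) =
  Data.List.Sort (On.decTotalOrder ≤-decTotalOrder layer)

module LayerStructure {n : ℕ} (G : Graph n) (u v w : Fin n)
  (F≤3 : ∀ a b → IsEdge G (a , b) → AtMost 3 (InF G (a , b)))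
  (uv : Adj G u v) (vw : Adj G v w) (u≢w : u ≢ w) where

  open Layers G u v w
  open GraphProperties G
  open EdgeProperties G
  open LayerProperties G u v w
  open PathCovers G
  open LayerSort layer using (sort; sort-↭; sort-↗)
  open PermutationSetoid (setoid (Fin n)) using (Unique-resp-↭)

  F≤3-edge : ∀ {a b} → Adj G a b → AtMost 3 (InF G (edge a b))
  F≤3-edge {a} {b} ab with edge a b | edge-IsEdge ab
  ... | (a′ , b′) | e-edge = F≤3 a′ b′ e-edge

  C-neighbour-closed : ∀ {x y c} → Outside y → InC c → Adj G y c → Adj G y x → ¬ InC x → Adj G x c
  C-neighbour-closed {x} {y} {c} y-out c∈C yc yx x∉C with Adj? x c | InC⇒Adj c∈C
  ... | yes xc | _            = xc
  ... | no ¬xc | cu , cv , cw = ⊥-elim (F≤3-edge yc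
        ( edge c u ∷ edge c v ∷ edge c w ∷ edge y x ∷ [] , refl
        , (cu≢cv ∷ cu≢cw ∷ c≢yx ∷ []) ∷ (cv≢cw ∷ c≢yx ∷ []) ∷ (c≢yx ∷ []) ∷ [] ∷ []
        , via (inj₁ refl) cu ∷ via (inj₂ (inj₁ refl)) cv ∷ via (inj₂ (inj₂ refl)) cw
          ∷ InF-pivotˡ (Adj-sym yc) yx c≢x (¬xc ∘ Adj-sym) ∷ [] ))
    where
    c≢x : c ≢ x
    c≢x refl = x∉C c∈C
    via : ∀ {a} → InA a → Adj G c a → InF G (edge y c) (edge c a)
    via a∈A ca = InF-pivotʳ yc ca (λ { refl → proj₁ y-out a∈A }) (Outside⇒¬Adj y-out a∈A)
    c-edge≢ : ∀ {a b} → a ≢ b → Adj G c a → edge c a ≢ edge c b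
    c-edge≢ a≢b ca same with edge-injective same
    ... | inj₁ (_ , a≡b) = a≢b a≡b
    ... | inj₂ (_ , a≡c) = Adj⇒≢ ca (sym a≡c)
    cu≢cv : edge c u ≢ edge c v
    cu≢cv = c-edge≢ (Adj⇒≢ uv) cu
    cu≢cw : edge c u ≢ edge c w
    cu≢cw = c-edge≢ u≢w cu
    cv≢cw : edge c v ≢ edge c w
    cv≢cw = c-edge≢ (Adj⇒≢ vw) cv
    c≢yx : ∀ {a} → edge c a ≢ edge y x
    c≢yx same with edge-injective same
    ... | inj₁ (c≡y , _) = Adj⇒≢ yc (sym c≡y)
    ... | inj₂ (c≡x , _) = c≢x c≡x

  lowerNeighbour : ∀ {i x} → Bl (suc i) x → ∃ λ y → Adj G x y × Bl i y
  lowerNeighbour {i} (x∉A , x∉B , x∉C , x∉D , dist) with DistB-pred dist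
  lowerNeighbour {zero}  _ | y , xy , (_ , y∈B , nil) , _ = y , xy , y∈B
  lowerNeighbour {suc i} (x∉A , x∉B , x∉C , x∉D , dist) | y , xy , dist′ =
    y , xy , (λ y∈A → Outside⇒¬Adj (x∉A , x∉B , x∉C) y∈A xy) ,
    (λ y∈B → proj₂ dist′ 0 (s≤s z≤n) y y∈B nil) ,
    (λ y∈C → x∉D (x∉A , x∉B , x∉C , y , y∈C , xy)) ,
    (λ (y∉A , y∉B , y∉C , c , c∈C , yc) →
       x∉D (x∉A , x∉B , x∉C , c , c∈C , C-neighbour-closed (y∉A , y∉B , y∉C) c∈C yc (Adj-sym xy) x∉C)) ,
    dist′

  privateNeighbour : ∀ {k y z} → Bl (suc k) y → Bl k z → ∃ λ r → Adj G z r × r ≢ y × ¬ Adj G y r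
  privateNeighbour {zero} (y∉A , y∉B , y∉C , _) z∈B =
    let a , a∈A , za = InB⇒neighbourInA z∈B
    in  a , za , (λ { refl → y∉A a∈A }) , Outside⇒¬Adj (y∉A , y∉B , y∉C) a∈A
  privateNeighbour {suc k} y∈ z∈ =
    let r , zr , r∈ = lowerNeighbour z∈
    in  r , zr , Bl⇒≢ r∈ y∈ (<⇒≢ (m<n⇒m<1+n (n<1+n _))) , Bl-¬Adj r∈ y∈ ≤-refl ∘ Adj-sym

  module Union (j : ℕ∞) (isJ : IsJ j) where

    InE-edge : ∀ {k y z} → Bl (suc k) y → Bl k z → Adj G y z → InE k (edge y z)
    InE-edge {y = y} {z} y∈ z∈ yz with edge y z | edge-≐ y z | edge-IsEdge yz
    ... | _ | inj₁ (refl , refl) | e-edge = e-edge , inj₂ (z∈ , y∈)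
    ... | _ | inj₂ (refl , refl) | e-edge = e-edge , inj₁ (z∈ , y∈)

    F≤2 : ∀ {k y z} → suc k ≤∞ j → Bl (suc k) y → Bl k z → Adj G y z → AtMost 2 (InF G (edge y z))
    F≤2 {y = y} {z} k<j y∈ z∈ yz three = IsJ⇒¬Heavy isJ k<j (edge y z , InE-edge y∈ z∈ yz , three)

    outerNeighbour-unique : ∀ {k y z p q} → suc k ≤∞ j → Bl (suc k) y → Bl k z → Adj G y z →
                            Adj G y p → Adj G y q → p ≢ z → q ≢ z → ¬ Adj G z p → ¬ Adj G z q → p ≡ q
    outerNeighbour-unique {y = y} {z} {p} {q} k<j y∈ z∈ yz yp yq p≢z q≢z ¬zp ¬zq
      with p ≟ᶠ q | privateNeighbour y∈ z∈
    ... | yes p≡q | _                  = p≡q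
    ... | no p≢q  | r , zr , r≢y , ¬yr = ⊥-elim (F≤2 k<j y∈ z∈ yz
          ( edge y p ∷ edge y q ∷ edge z r ∷ [] , refl
          , (yp≢yq ∷ y≢zr ∷ []) ∷ (y≢zr ∷ []) ∷ [] ∷ []
          , InF-pivotˡ (Adj-sym yz) yp (p≢z ∘ sym) ¬zp
          ∷ InF-pivotˡ (Adj-sym yz) yq (q≢z ∘ sym) ¬zq
          ∷ InF-pivotʳ yz zr (r≢y ∘ sym) ¬yr ∷ [] ))
      where
      yp≢yq : edge y p ≢ edge y q
      yp≢yq same with edge-injective same
      ... | inj₁ (_ , p≡q) = p≢q p≡q
      ... | inj₂ (y≡q , _) = Adj⇒≢ yq y≡q
      y≢zr : ∀ {a} → edge y a ≢ edge z r
      y≢zr same with edge-injective same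
      ... | inj₁ (y≡z , _) = Adj⇒≢ yz y≡z
      ... | inj₂ (y≡r , _) = r≢y (sym y≡r)

    Upper : ℕ → Fin n → Set
    Upper i s = Bl (2 + i) s ⊎ Bl (3 + i) s

    Upper⇒Bl : ∀ {i s} → Upper i s → ∃ λ k → 2 + i ≤ k × Bl k s
    Upper⇒Bl (inj₁ s∈) = _ , ≤-refl , s∈
    Upper⇒Bl (inj₂ s∈) = _ , n≤1+n _ , s∈

    -- With y ∈ B_{i+1} below x and z ∈ B_i below y, the upper neighbours of x lie outside N[y],
    -- since an upper neighbour p of x adjacent to y would give y the two outer neighbours x and p.
    upperNeighbour-unique : ∀ {i x s t} → (2 + i) ≤∞ j → Bl (2 + i) x → Adj G x s → Adj G x t →
                            Upper i s → Upper i t → s ≡ t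
    upperNeighbour-unique {i} {x} le x∈ xs xt s↑ t↑ with lowerNeighbour x∈
    ... | y , xy , y∈ with lowerNeighbour y∈
    ... | z , yz , z∈ =
      outerNeighbour-unique le x∈ y∈ xy xs xt (≢y s↑) (≢y t↑) (¬y s↑ xs) (¬y t↑ xt)
      where
      ≢y : ∀ {p} → Upper i p → p ≢ y
      ≢y p↑ = let _ , 2+i≤k , p∈ = Upper⇒Bl p↑ in Bl⇒≢ p∈ y∈ (<⇒≢ 2+i≤k ∘ sym)
      ¬y : ∀ {p} → Upper i p → Adj G x p → ¬ Adj G y p
      ¬y p↑ xp yp =
        let _ , 2+i≤k , p∈ = Upper⇒Bl p↑
            i<k = ≤-trans (n≤1+n _) 2+i≤k
        in  Adj⇒≢ xp (outerNeighbour-unique (≤∞-pred le) y∈ z∈ yz (Adj-sym xy) yp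
                        (Bl⇒≢ x∈ z∈ (<⇒≢ (m<n⇒m<1+n (n<1+n i)) ∘ sym)) (Bl⇒≢ p∈ z∈ (<⇒≢ i<k ∘ sym))
                        (Bl-¬Adj z∈ x∈ ≤-refl) (Bl-¬Adj z∈ p∈ 2+i≤k))

    lower-or-upper : ∀ {i x p} → Bl (2 + i) x → InUnion j p → Adj G x p → Bl (suc i) p ⊎ Upper i p
    lower-or-upper {i} x∈ (k , _ , _ , p∈) xp with Bl-Adj-cases {2 + i} {k} x∈ p∈ xp
    ... | inj₁ refl        = inj₁ p∈
    ... | inj₂ (inj₁ refl) = inj₂ (inj₁ p∈)
    ... | inj₂ (inj₂ refl) = inj₂ (inj₂ p∈)

    upperNeighbour-avoids-lower : ∀ {i x y p} → (3 + i) ≤∞ j → Bl (3 + i) x → Bl (2 + i) y →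
                                  Adj G x y → Adj G x p → InUnion j p → ¬ Adj G y p
    upperNeighbour-avoids-lower {i} le x∈ y∈ xy xp (k , _ , _ , p∈) yp with Bl-Adj-cases {3 + i} {k} x∈ p∈ xp
    ... | inj₁ refl        =
      Adj⇒≢ xp (upperNeighbour-unique (≤∞-pred le) y∈ (Adj-sym xy) yp (inj₂ x∈) (inj₁ p∈))
    ... | inj₂ (inj₁ refl) =
      Adj⇒≢ xp (upperNeighbour-unique (≤∞-pred le) y∈ (Adj-sym xy) yp (inj₂ x∈) (inj₂ p∈))
    ... | inj₂ (inj₂ refl) = Bl-¬Adj y∈ p∈ ≤-refl yp

    lowerNeighbour-excludes : ∀ {i x y p q} → (2 + i) ≤∞ j → Bl (2 + i) x → Bl (suc i) y →
                              InUnion j y → InUnion j p → InUnion j q →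
                              Adj G x y → Adj G x p → Adj G x q → p ≢ y → q ≢ y → p ≡ q
    lowerNeighbour-excludes {zero} _ _ y∈ (k , 2≤k , _ , y∈′) _ _ _ _ _ _ _ with Bl-unique {1} {k} y∈ y∈′ | 2≤k
    ... | refl | s≤s ()
    lowerNeighbour-excludes {suc i} le x∈ y∈ _ p∪ q∪ xy xp xq p≢y q≢y =
      outerNeighbour-unique le x∈ y∈ xy xp xq p≢y q≢y
        (upperNeighbour-avoids-lower le x∈ y∈ xy xp p∪) (upperNeighbour-avoids-lower le x∈ y∈ xy xq q∪)

    union-degree≤2 : ∀ {x a b c} → InUnion j x → InUnion j a → InUnion j b → InUnion j c →
                     Adj G x a → Adj G x b → Adj G x c → a ≢ b → a ≢ c → b ≢ c → ⊥
    union-degree≤2 (suc (suc i) , s≤s (s≤s z≤n) , le , x∈) a∪ b∪ c∪ xa xb xc a≢b a≢c b≢c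
      with lower-or-upper x∈ a∪ xa | lower-or-upper x∈ b∪ xb
    ... | inj₁ a∈ | _      = b≢c (lowerNeighbour-excludes le x∈ a∈ a∪ b∪ c∪ xa xb xc (a≢b ∘ sym) (a≢c ∘ sym))
    ... | inj₂ _  | inj₁ b∈ = a≢c (lowerNeighbour-excludes le x∈ b∈ b∪ a∪ c∪ xb xa xc a≢b (b≢c ∘ sym))
    ... | inj₂ a↑ | inj₂ b↑ = a≢b (upperNeighbour-unique le x∈ xa xb a↑ b↑)

    unionVertices : List (Fin n)
    unionVertices = sort (filter (InUnion? j) (allFin n))

    ∈-unionVertices : ∀ {x} → x ∈ unionVertices ⇔ InUnion j x
    ∈-unionVertices {x} =
      mk⇔ (λ x∈ → proj₂ (∈-filter⁻ (InUnion? j) {xs = allFin n} (∈-resp-↭ (sort-↭ _) x∈)))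
          (λ x∪ → ∈-resp-↭ (↭-sym (sort-↭ _)) (∈-filter⁺ (InUnion? j) (∈-allFin x) x∪))

    unionVertices-unique : Unique unionVertices
    unionVertices-unique =
      Unique-resp-↭ (↭⇒↭ₛ (↭-sym (sort-↭ _))) (Unique.filter⁺ (InUnion? j) (Unique.allFin⁺ n))

    unionVertices-sorted : AllPairs (λ x y → layer x ≤ layer y) unionVertices
    unionVertices-sorted = Linked⇒AllPairs ≤-trans (sort-↗ _)

    layer-sorted⇒PathOrdered : ∀ xs → AllPairs (λ x y → layer x ≤ layer y) xs → All (InUnion j) xs →
                               Unique xs → PathOrdered xs
    layer-sorted⇒PathOrdered []       _              _              _         = tt
    layer-sorted⇒PathOrdered (m ∷ xs) (m≤xs ∷ sorted) (m∪ ∷ xs∪) (m∉ ∷ u) =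
      (one-upper m∪ m≤xs , degree) , layer-sorted⇒PathOrdered xs sorted xs∪ u
      where
      one-upper : InUnion j m → All (λ y → layer m ≤ layer y) xs → AtMostOneNeighbourIn m xs
      one-upper (suc (suc i) , s≤s (s≤s z≤n) , le , m∈) m≤xs {y} {y′} y∈ y′∈ my my′ =
        upperNeighbour-unique le m∈ my my′ (upper y∈ my) (upper y′∈ my′)
        where
        upper : ∀ {y} → y ∈ xs → Adj G m y → Upper i y
        upper y∈ my with lower-or-upper m∈ (All.lookup xs∪ y∈) my
        ... | inj₂ y↑ = y↑
        ... | inj₁ y∈ᵢ = ⊥-elim (<⇒≱ (Bl⇒layer< y∈ᵢ m∈) (All.lookup m≤xs y∈))
      degree : ∀ {t} → t ∈ xs → Adj G m t → AtMostOneNeighbourIn t xs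
      degree t∈ mt {y} {y′} y∈ y′∈ ty ty′ with y ≟ᶠ y′
      ... | yes y≡y′ = y≡y′
      ... | no y≢y′  = ⊥-elim (union-degree≤2 (All.lookup xs∪ t∈) m∪ (All.lookup xs∪ y∈) (All.lookup xs∪ y′∈)
                          (Adj-sym mt) ty ty′ (All.lookup m∉ y∈) (All.lookup m∉ y′∈) y≢y′)

    unionVertices-PathOrdered : PathOrdered unionVertices
    unionVertices-PathOrdered = layer-sorted⇒PathOrdered unionVertices unionVertices-sorted
                                  (All.tabulate (⇔.to ∈-unionVertices)) unionVertices-unique

    Rooted : List (Fin n) → Set
    Rooted P = ∃ λ r → r ∈ P × Bl 2 r

    -- A vertex of least layer on a path lies in B₂: otherwise its lower neighbour, being in the
    -- union and adjacent to it, would lie on the same path.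
    pathRoot : ∀ {ps} → PathCover unionVertices ps → ∀ {P} → P ∈ ps → Rooted P
    pathRoot cover {P} P∈ with ∃-minimal layer P (All.lookup (PathCover.nonEmpty cover) P∈)
    ... | r , r∈P , minimal with ⇔.to ∈-unionVertices (⇔.to (PathCover.members cover) (∈-concat⁺′ r∈P P∈))
    ...   | suc zero , s≤s () , _
    ...   | suc (suc zero) , _ , _ , r∈ = r , r∈P , r∈
    ...   | suc (suc (suc l)) , _ , le , r∈ with lowerNeighbour r∈
    ...     | y , ry , y∈ with find (PathCover.adj⇒linked cover
                                   (⇔.from ∈-unionVertices (_ , s≤s (s≤s z≤n) , le , r∈))
                                   (⇔.from ∈-unionVertices (_ , s≤s (s≤s z≤n) , ≤∞-pred le , y∈)) ry)
    ...       | Q , Q∈ , nb with concat-unique⇒≡ (PathCover.unique cover) Q∈ P∈ (Neighbours⇒∈ˡ nb) r∈P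
    ...         | refl = ⊥-elim (<⇒≱ (Bl⇒layer< y∈ r∈) (All.lookup minimal (Neighbours⇒∈ʳ nb)))

    RootEdge : List (List (Fin n)) → Fin n × Fin n → Set
    RootEdge qs e = ∃ λ r → r ∈ concat qs × Bl 2 r × ∃ λ y → Bl 1 y × Adj G r y × e ≡ edge r y

    RootEdge⇒InE₁ : ∀ {qs e} → RootEdge qs e → InE 1 e
    RootEdge⇒InE₁ (r , _ , r∈ , y , y∈ , ry , refl) = InE-edge {1} r∈ y∈ ry

    rootEdges : ∀ qs → All Rooted qs → Unique (concat qs) →
                ∃ λ es → length es ≡ length qs × Unique es × All (RootEdge qs) es
    rootEdges []       []                         _ = [] , refl , [] , []
    rootEdges (P ∷ qs) ((r , r∈P , r∈) ∷ rooted) u with lowerNeighbour r∈ | rootEdges qs rooted (unique-++⁻ʳ P u)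
    ... | y , ry , y∈ | es , length≡ , es-unique , es-root =
      edge r y ∷ es , cong suc length≡ , All.map fresh es-root ∷ es-unique ,
      (r , ∈-++⁺ˡ r∈P , r∈ , y , y∈ , ry , refl) ∷ All.map weaken es-root
      where
      fresh : ∀ {e} → RootEdge qs e → edge r y ≢ e
      fresh (r′ , r′∈ , _ , y′ , y′∈ , _ , refl) same with edge-injective same
      ... | inj₁ (refl , _) = unique-++⁻-disjoint P u (r∈P , r′∈)
      ... | inj₂ (refl , _) = Bl⇒≢ {2} {1} r∈ y′∈ (λ ()) refl
      weaken : ∀ {e} → RootEdge qs e → RootEdge (P ∷ qs) e
      weaken (r′ , r′∈ , rest) = r′ , ∈-++⁺ʳ P r′∈ , rest

    unionOfPaths : Σ (List (List (Fin n))) λ ps →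
                     IsDisjointUnionOfPaths G (InUnion j) ps × AtLeast (length ps) (InE 1)
    unionOfPaths with pathCover unionVertices unionVertices-unique unionVertices-PathOrdered
    ... | ps , cover with rootEdges ps (All.tabulate (pathRoot cover)) (PathCover.unique cover)
    ... | es , length≡ , es-unique , es-root =
      ps , PathCover⇒IsDisjointUnionOfPaths ∈-unionVertices cover ,
      es , length≡ , es-unique , All.map (RootEdge⇒InE₁ {ps}) es-root

corollary2 : {n : ℕ} (G : Graph n) → C4Free G →
    (∀ a b → IsEdge G (a , b) → AtMost 3 (InF G (a , b))) →
    (u v w : Fin n) → Adj G u v → Adj G v w → ¬ Adj G u w → u ≢ w →
    (j : ℕ∞) → Layers.IsJ G u v w j → 2 ≤∞ j →
    Σ (List (List (Fin n))) λ ps →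
      IsDisjointUnionOfPaths G (Layers.InUnion G u v w j) ps ×
      AtLeast (length ps) (Layers.InE G u v w 1)
corollary2 G _ F≤3 u v w uv vw _ u≢w j isJ _ = LayerStructure.Union.unionOfPaths G u v w F≤3 uv vw u≢w j isJ
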